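{- For every positive integer $n$ with $n \equiv 0 \pmod 4$ or $n \equiv 1 \pmod 4$, the transitive tournament $TT_n$ admits a chain--collider--fork decomposition consisting of exactly $\left\lfloor \frac{n}{4}\right\rfloor$ forks, $\frac{n(n-1)}{4}-\left\lfloor \frac{n}{4}\right\rfloor$ colliders, and $0$ chains.
   Context: The transitive tournament $TT_n$ has vertex set $\{v_1,\dots,v_n\}$ and arc set $\{(v_i,v_j): 1\le i<j\le n\}$ (an arc $(u,v)$ is written $u\to v$). A chain is a digraph on three distinct vertices with arcs $a\to b\to c$; a collider is one with arcs $a\to b\leftarrow c$; a fork is one with arcs $a\leftarrow b\to c$. A chain--collider--fork decomposition of $TT_n$ is a partition of the arc set of $TT_n$ into two-element sets of arcs, each of which forms (as a subdigraph) a chain, a collider, or a fork. -}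

module Defs where

open import Data.Nat using (ℕ)
open import Data.Fin using (Fin; _<?_)
open import Data.Fin.Properties using ()
open import Data.List using (List; []; _∷_; filter; cartesianProduct; allFin; concatMap; length)
open import Data.Product using (_×_; _,_; Σ; proj₁; proj₂)
open import Relation.Binary.PropositionalEquality using (_≡_; _≢_; refl)
open import Relation.Nullary using (Dec; yes; no)
open import Data.List.Relation.Binary.Permutation.Propositional using (_↭_)

-- An arc u → v of a digraph on vertex set Fin n, written (u , v).
Arc : ℕ → Set
Arc n = Fin n × Fin n

arcsTT : (n : ℕ) → List (Arc n)
arcsTT n = filter (λ p → proj₁ p <? proj₂ p) (cartesianProduct (allFin n) (allFin n))

data Shape : Set where
  chain collider fork : Shape

Distinct3 : {n : ℕ} → Fin n → Fin n → Fin n → Set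
Distinct3 a b c = (a ≢ b) × (b ≢ c) × (a ≢ c)

data Forms {n : ℕ} : Arc n → Arc n → Shape → Set where
  chain₁   : ∀ {a b c} → Distinct3 a b c → Forms (a , b) (b , c) chain
  chain₂   : ∀ {a b c} → Distinct3 a b c → Forms (b , c) (a , b) chain
  collider : ∀ {a b c} → Distinct3 a b c → Forms (a , b) (c , b) collider
  fork     : ∀ {a b c} → Distinct3 a b c → Forms (b , a) (b , c) fork

record Block (n : ℕ) : Set where
  constructor block
  field
    arc₁  : Arc n
    arc₂  : Arc n
    shape : Shape
    forms : Forms arc₁ arc₂ shape

open Block public

blockArcs : {n : ℕ} → Block n → List (Arc n)
blockArcs b = arc₁ b ∷ arc₂ b ∷ []

-- A chain–collider–fork decomposition of TT_n: a list of blocks whose arcs,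
-- taken together (with multiplicity), are exactly the arcs of TT_n
-- (i.e. the blocks partition the arc set).
IsCCFDecomposition : (n : ℕ) → List (Block n) → Set
IsCCFDecomposition n D = concatMap blockArcs D ↭ arcsTT n

_≟S_ : (s t : Shape) → Dec (s ≡ t)
chain ≟S chain = yes refl
chain ≟S collider = no (λ ())
chain ≟S fork = no (λ ())
collider ≟S chain = no (λ ())
collider ≟S collider = yes refl
collider ≟S fork = no (λ ())
fork ≟S chain = no (λ ())
fork ≟S collider = no (λ ())
fork ≟S fork = yes refl

count : {n : ℕ} → Shape → List (Block n) → ℕ
count s D = length (filter (λ b → shape b ≟S s) D)

-- Place four new sources v₀ v₁ v₂ v₃ in front of TT_n.  The six arcs among them split into
-- the fork {v₀v₁, v₀v₃} and the colliders {v₀v₂, v₁v₂} and {v₁v₃, v₂v₃}; the eight arcs into an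
-- old vertex w split into the colliders {v₀w, v₁w} and {v₂w, v₃w}.  So a decomposition of TT_n
-- extends to one of TT_(n+4) with one more fork and no new chain, and starting from the arcless
-- TT_0 or TT_1 gives ⌊n/4⌋ forks and no chains.  The number of colliders is then forced, since
-- every decomposition of TT_n has n(n-1)/4 blocks.
module Submission where

open import Defs
open import Data.Nat using (ℕ; zero; suc; _+_; _*_; _∸_; _%_; _/_; NonZero; s≤s; z≤n; s≤s⁻¹)
open import Data.Nat.DivMod using (m*n/n≡m; m≡m%n+[m/n]*n)
open import Data.Nat.Properties using (*-distribʳ-+; *-distribˡ-+; *-comm; *-assoc; +-comm; +-suc; m+n∸n≡m)
open import Data.Fin using (Fin; zero; suc; _<_; _<?_; _↑ʳ_)
open import Data.Fin.Properties using (↑ʳ-injective)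
open import Data.List using (List; []; _∷_; [_]; _++_; map; filter; tabulate; allFin; cartesianProduct; length; concatMap)
open import Data.List.Properties using (filter-++; filter-all; filter-none; filter-≐; map-tabulate; map-++; map-∘; concatMap-++; length-++; length-tabulate; length-map)
open import Data.List.Relation.Unary.All using (All)
open import Data.List.Relation.Unary.All.Properties using (tabulate⁺)
open import Data.Product using (Σ; _×_; _,_; proj₁; proj₂)
open import Data.Sum using (_⊎_; inj₁; inj₂)
open import Relation.Nullary using (Dec; does)
open import Relation.Unary using (Pred; Decidable; _≐_)
open import Data.List.Relation.Binary.Permutation.Propositional using (_↭_; ↭-refl; ↭-sym; ↭-trans; prep; module PermutationReasoning)
open import Data.List.Relation.Binary.Permutation.Propositional.Properties using (↭-length; shift; ++⁺ˡ; ++⁺; map⁺; ++-commutativeMonoid)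
open import Function.Definitions using (Injective)
open import Relation.Binary.PropositionalEquality using (_≡_; _≢_; refl; sym; trans; cong; cong₂; subst; module ≡-Reasoning)
open import Data.Bool using (true; false)
open import Function using (_∘_; id)
open import Level using (Level)

private
  variable
    a b p : Level
    A B : Set a
    k m n : ℕ

filter-map : {P : Pred B p} (P? : Decidable P) (f : A → B) (xs : List A) →
             filter P? (map f xs) ≡ map f (filter (P? ∘ f) xs)
filter-map P? f [] = refl
filter-map P? f (x ∷ xs) with does (P? (f x))
... | true  = cong (f x ∷_) (filter-map P? f xs)
... | false = filter-map P? f xs

renameArc : (Fin m → Fin n) → Arc m → Arc n
renameArc f (i , j) = f i , f j

cartesianProduct-map : (f : Fin m → Fin n) (xs ys : List (Fin m)) →
  cartesianProduct (map f xs) (map f ys) ≡ map (renameArc f) (cartesianProduct xs ys)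
cartesianProduct-map f [] ys = refl
cartesianProduct-map f (x ∷ xs) ys = begin
  map (f x ,_) (map f ys) ++ cartesianProduct (map f xs) (map f ys)
    ≡⟨ cong₂ _++_ (sym (map-∘ ys)) (cartesianProduct-map f xs ys) ⟩
  map (renameArc f ∘ (x ,_)) ys ++ map (renameArc f) (cartesianProduct xs ys)
    ≡⟨ cong (_++ _) (map-∘ ys) ⟩
  map (renameArc f) (map (x ,_) ys) ++ map (renameArc f) (cartesianProduct xs ys)
    ≡⟨ map-++ (renameArc f) (map (x ,_) ys) _ ⟨
  map (renameArc f) (cartesianProduct (x ∷ xs) ys) ∎
  where open ≡-Reasoning

forward? : (p : Arc n) → Dec (proj₁ p < proj₂ p)
forward? p = proj₁ p <? proj₂ p

filter-forward-no-arc-into-zero : (xs : List (Fin (suc n))) (ys : List (Fin (suc n))) →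
  filter forward? (cartesianProduct xs (zero ∷ ys)) ≡ filter forward? (cartesianProduct xs ys)
filter-forward-no-arc-into-zero [] ys = refl
filter-forward-no-arc-into-zero (x ∷ xs) ys = begin
  filter forward? (map (x ,_) ys ++ cartesianProduct xs (zero ∷ ys))
    ≡⟨ filter-++ forward? (map (x ,_) ys) _ ⟩
  filter forward? (map (x ,_) ys) ++ filter forward? (cartesianProduct xs (zero ∷ ys))
    ≡⟨ cong (filter forward? (map (x ,_) ys) ++_) (filter-forward-no-arc-into-zero xs ys) ⟩
  filter forward? (map (x ,_) ys) ++ filter forward? (cartesianProduct xs ys)
    ≡⟨ filter-++ forward? (map (x ,_) ys) _ ⟨
  filter forward? (cartesianProduct (x ∷ xs) ys) ∎
  where open ≡-Reasoning

filter-forward-renameArc-suc : (ps : List (Arc n)) →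
  filter forward? (map (renameArc suc) ps) ≡ map (renameArc suc) (filter forward? ps)
filter-forward-renameArc-suc ps = trans (filter-map forward? (renameArc suc) ps)
  (cong (map (renameArc suc)) (filter-≐ (forward? ∘ renameArc suc) forward? (s≤s⁻¹ , s≤s) ps))

arcsFromZero : (n : ℕ) → List (Arc (suc n))
arcsFromZero n = tabulate (λ j → zero , suc j)

arcsTT-suc : (n : ℕ) → arcsTT (suc n) ≡ arcsFromZero n ++ map (renameArc suc) (arcsTT n)
arcsTT-suc n = begin
  filter forward? (cartesianProduct (zero ∷ others) (zero ∷ others))
    ≡⟨ filter-forward-no-arc-into-zero (zero ∷ others) others ⟩
  filter forward? (map (zero ,_) others ++ cartesianProduct others others)
    ≡⟨ filter-++ forward? (map (zero ,_) others) _ ⟩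
  filter forward? (map (zero ,_) others) ++ filter forward? (cartesianProduct others others)
    ≡⟨ cong₂ _++_ fromZero rest ⟩
  arcsFromZero n ++ map (renameArc suc) (arcsTT n) ∎
  where
  open ≡-Reasoning
  others : List (Fin (suc n))
  others = tabulate suc
  others≡map-suc : others ≡ map suc (allFin n)
  others≡map-suc = sym (map-tabulate id suc)
  fromZero : filter forward? (map (zero ,_) others) ≡ arcsFromZero n
  fromZero = trans (cong (filter forward?) (map-tabulate suc (zero ,_)))
                   (filter-all forward? (tabulate⁺ (λ _ → s≤s z≤n)))
  rest : filter forward? (cartesianProduct others others) ≡ map (renameArc suc) (arcsTT n)
  rest = trans (cong (λ xs → filter forward? (cartesianProduct xs xs)) others≡map-suc)
         (trans (cong (filter forward?) (cartesianProduct-map suc (allFin n) (allFin n)))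
                (filter-forward-renameArc-suc (cartesianProduct (allFin n) (allFin n))))

map-renameArc-arcsTT-suc : (f : Fin (suc n) → Fin m) →
  map (renameArc f) (arcsTT (suc n)) ≡ tabulate (λ j → f zero , f (suc j)) ++ map (renameArc (f ∘ suc)) (arcsTT n)
map-renameArc-arcsTT-suc {n} f = begin
  map (renameArc f) (arcsTT (suc n))
    ≡⟨ cong (map (renameArc f)) (arcsTT-suc n) ⟩
  map (renameArc f) (arcsFromZero n ++ map (renameArc suc) (arcsTT n))
    ≡⟨ map-++ (renameArc f) (arcsFromZero n) _ ⟩
  map (renameArc f) (arcsFromZero n) ++ map (renameArc f) (map (renameArc suc) (arcsTT n))
    ≡⟨ cong₂ _++_ (map-tabulate _ (renameArc f)) (sym (map-∘ (arcsTT n))) ⟩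
  tabulate (λ j → f zero , f (suc j)) ++ map (renameArc (f ∘ suc)) (arcsTT n) ∎
  where open ≡-Reasoning

length-arcsTT : (n : ℕ) → length (arcsTT n) * 2 ≡ n * (n ∸ 1)
length-arcsTT zero = refl
length-arcsTT (suc n) = begin
  length (arcsTT (suc n)) * 2
    ≡⟨ cong (λ as → length as * 2) (arcsTT-suc n) ⟩
  length (arcsFromZero n ++ map (renameArc suc) (arcsTT n)) * 2
    ≡⟨ cong (_* 2) (length-++ (arcsFromZero n)) ⟩
  (length (arcsFromZero n) + length (map (renameArc suc) (arcsTT n))) * 2
    ≡⟨ cong (_* 2) (cong₂ _+_ (length-tabulate {A = Arc (suc n)} (λ j → zero , suc j)) (length-map _ (arcsTT n))) ⟩
  (n + length (arcsTT n)) * 2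
    ≡⟨ *-distribʳ-+ 2 n _ ⟩
  n * 2 + length (arcsTT n) * 2
    ≡⟨ cong (n * 2 +_) (length-arcsTT n) ⟩
  n * 2 + n * (n ∸ 1)
    ≡⟨ n*2+n*[n∸1]≡[1+n]*n n ⟩
  suc n * n ∎
  where
  open ≡-Reasoning
  n*2+n*[n∸1]≡[1+n]*n : (n : ℕ) → n * 2 + n * (n ∸ 1) ≡ suc n * n
  n*2+n*[n∸1]≡[1+n]*n zero = refl
  n*2+n*[n∸1]≡[1+n]*n (suc n) = trans (sym (*-distribˡ-+ (suc n) 2 n)) (*-comm (suc n) (2 + n))

renameDistinct3 : {f : Fin m → Fin n} → Injective _≡_ _≡_ f →
  {x y z : Fin m} → Distinct3 x y z → Distinct3 (f x) (f y) (f z)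
renameDistinct3 inj (x≢y , y≢z , x≢z) = x≢y ∘ inj , y≢z ∘ inj , x≢z ∘ inj

renameForms : {f : Fin m → Fin n} → Injective _≡_ _≡_ f →
  {e₁ e₂ : Arc m} {s : Shape} → Forms e₁ e₂ s → Forms (renameArc f e₁) (renameArc f e₂) s
renameForms inj (chain₁ d)   = chain₁ (renameDistinct3 inj d)
renameForms inj (chain₂ d)   = chain₂ (renameDistinct3 inj d)
renameForms inj (collider d) = collider (renameDistinct3 inj d)
renameForms inj (fork d)     = fork (renameDistinct3 inj d)

renameBlock : (f : Fin m → Fin n) → Injective _≡_ _≡_ f → Block m → Block n
renameBlock f inj (block e₁ e₂ s forms) = block (renameArc f e₁) (renameArc f e₂) s (renameForms inj forms)

concatMap-blockArcs-renameBlock : (f : Fin m → Fin n) (inj : Injective _≡_ _≡_ f) (D : List (Block m)) →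
  concatMap blockArcs (map (renameBlock f inj) D) ≡ map (renameArc f) (concatMap blockArcs D)
concatMap-blockArcs-renameBlock f inj []      = refl
concatMap-blockArcs-renameBlock f inj (b ∷ D) = cong (λ as → _ ∷ _ ∷ as) (concatMap-blockArcs-renameBlock f inj D)

concatMap-blockArcs-tabulate : (h : Fin k → Block n) →
  concatMap blockArcs (tabulate h) ↭ tabulate (arc₁ ∘ h) ++ tabulate (arc₂ ∘ h)
concatMap-blockArcs-tabulate {zero}  h = ↭-refl
concatMap-blockArcs-tabulate {suc k} h = prep (arc₁ (h zero)) (↭-trans
  (prep (arc₂ (h zero)) (concatMap-blockArcs-tabulate (h ∘ suc)))
  (↭-sym (shift (arc₂ (h zero)) (tabulate (arc₁ ∘ h ∘ suc)) _)))

length-concatMap-blockArcs : (D : List (Block n)) → length (concatMap blockArcs D) ≡ length D * 2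
length-concatMap-blockArcs []      = refl
length-concatMap-blockArcs (b ∷ D) = cong (2 +_) (length-concatMap-blockArcs D)

hasShape? : (s : Shape) (b : Block n) → Dec (shape b ≡ s)
hasShape? s b = shape b ≟S s

count-++ : (s : Shape) (D E : List (Block n)) → count s (D ++ E) ≡ count s D + count s E
count-++ s D E = trans (cong length (filter-++ (hasShape? s) D E)) (length-++ (filter (hasShape? s) D))

count-map : (s : Shape) (f : Block m → Block n) → (∀ b → shape (f b) ≡ shape b) →
  (D : List (Block m)) → count s (map f D) ≡ count s D
count-map s f shape-f D = begin
  length (filter (hasShape? s) (map f D))       ≡⟨ cong length (filter-map (hasShape? s) f D) ⟩
  length (map f (filter (hasShape? s ∘ f) D))   ≡⟨ length-map f (filter (hasShape? s ∘ f) D) ⟩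
  length (filter (hasShape? s ∘ f) D)
    ≡⟨ cong length (filter-≐ (hasShape? s ∘ f) (hasShape? s) same D) ⟩
  count s D ∎
  where
  open ≡-Reasoning
  same : (λ b → shape (f b) ≡ s) ≐ (λ b → shape b ≡ s)
  same = (λ {b} e → trans (sym (shape-f b)) e) , (λ {b} e → trans (shape-f b) e)

count-none : (s : Shape) (D : List (Block n)) → All (λ b → shape b ≢ s) D → count s D ≡ 0
count-none s D none = cong length (filter-none (hasShape? s) none)

count-shapes : (D : List (Block n)) → count chain D + (count collider D + count fork D) ≡ length D
count-shapes [] = refl
count-shapes (block _ _ chain _ ∷ D) = cong suc (count-shapes D)
count-shapes (block _ _ collider _ ∷ D) = trans (+-suc (count chain D) _) (cong suc (count-shapes D))
count-shapes (block _ _ fork _ ∷ D) = begin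
  count chain D + (count collider D + suc (count fork D)) ≡⟨ cong (count chain D +_) (+-suc (count collider D) _) ⟩
  count chain D + suc (count collider D + count fork D)   ≡⟨ +-suc (count chain D) _ ⟩
  suc (count chain D + (count collider D + count fork D)) ≡⟨ cong suc (count-shapes D) ⟩
  suc (length D) ∎
  where open ≡-Reasoning

module _ {n : ℕ} where
  private
    v₀ v₁ v₂ v₃ : Fin (4 + n)
    v₀ = zero
    v₁ = suc zero
    v₂ = suc (suc zero)
    v₃ = suc (suc (suc zero))

    old : Fin n → Fin (4 + n)
    old = 4 ↑ʳ_

    renameOld : Block n → Block (4 + n)
    renameOld = renameBlock old (↑ʳ-injective 4 _ _)

    arcsToOld : Fin (4 + n) → List (Arc (4 + n))
    arcsToOld x = tabulate (λ j → x , old j)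

  arcsTT-4+ : arcsTT (4 + n) ≡
    (v₀ , v₁) ∷ (v₀ , v₂) ∷ (v₀ , v₃) ∷ arcsToOld v₀ ++
    (v₁ , v₂) ∷ (v₁ , v₃) ∷ arcsToOld v₁ ++
    (v₂ , v₃) ∷ arcsToOld v₂ ++
    arcsToOld v₃ ++ map (renameArc old) (arcsTT n)
  arcsTT-4+ =
    trans (arcsTT-suc (3 + n)) (cong (arcsFromZero (3 + n) ++_)
    (trans (map-renameArc-arcsTT-suc (1 ↑ʳ_)) (cong (tabulate (λ j → v₁ , suc (suc j)) ++_)
    (trans (map-renameArc-arcsTT-suc (2 ↑ʳ_)) (cong (tabulate (λ j → v₂ , suc (suc (suc j))) ++_)
    (map-renameArc-arcsTT-suc (3 ↑ʳ_)))))))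

  private
    tt₄Blocks : List (Block (4 + n))
    tt₄Blocks =
      block (v₀ , v₁) (v₀ , v₃) fork (fork ((λ ()) , (λ ()) , (λ ()))) ∷
      block (v₀ , v₂) (v₁ , v₂) collider (collider ((λ ()) , (λ ()) , (λ ()))) ∷
      block (v₁ , v₃) (v₂ , v₃) collider (collider ((λ ()) , (λ ()) , (λ ()))) ∷ []

    colliders₀₁ colliders₂₃ : Fin n → Block (4 + n)
    colliders₀₁ j = block (v₀ , old j) (v₁ , old j) collider (collider ((λ ()) , (λ ()) , (λ ())))
    colliders₂₃ j = block (v₂ , old j) (v₃ , old j) collider (collider ((λ ()) , (λ ()) , (λ ())))

  extend : List (Block n) → List (Block (4 + n))
  extend D = tt₄Blocks ++ tabulate colliders₀₁ ++ tabulate colliders₂₃ ++ map renameOld D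

  extend-isCCFDecomposition : (D : List (Block n)) → IsCCFDecomposition n D → IsCCFDecomposition (4 + n) (extend D)
  extend-isCCFDecomposition D D↭ = begin
    concatMap blockArcs (extend D)
      ≡⟨ cong (concatMap blockArcs tt₄Blocks ++_) (concatMap-++³ (tabulate colliders₀₁) (tabulate colliders₂₃)) ⟩
    concatMap blockArcs tt₄Blocks ++
      concatMap blockArcs (tabulate colliders₀₁) ++ concatMap blockArcs (tabulate colliders₂₃) ++
      map (renameArc old) (concatMap blockArcs D)
      ↭⟨ ++⁺ˡ (concatMap blockArcs tt₄Blocks) (++⁺ (concatMap-blockArcs-tabulate colliders₀₁)
           (++⁺ (concatMap-blockArcs-tabulate colliders₂₃) (map⁺ (renameArc old) D↭))) ⟩
    concatMap blockArcs tt₄Blocks ++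
      (arcsToOld v₀ ++ arcsToOld v₁) ++ (arcsToOld v₂ ++ arcsToOld v₃) ++ map (renameArc old) (arcsTT n)
      ↭⟨ regroup (v₀ , v₁) (v₀ , v₃) (v₀ , v₂) (v₁ , v₂) (v₁ , v₃) (v₂ , v₃)
           (arcsToOld v₀) (arcsToOld v₁) (arcsToOld v₂) (arcsToOld v₃) (map (renameArc old) (arcsTT n)) ⟩
    (v₀ , v₁) ∷ (v₀ , v₂) ∷ (v₀ , v₃) ∷ arcsToOld v₀ ++
    (v₁ , v₂) ∷ (v₁ , v₃) ∷ arcsToOld v₁ ++
    (v₂ , v₃) ∷ arcsToOld v₂ ++
    arcsToOld v₃ ++ map (renameArc old) (arcsTT n)
      ≡⟨ arcsTT-4+ ⟨
    arcsTT (4 + n) ∎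
    where
    open PermutationReasoning
    concatMap-++³ : (T₀₁ T₂₃ : List (Block (4 + n))) → concatMap blockArcs (T₀₁ ++ T₂₃ ++ map renameOld D) ≡
      concatMap blockArcs T₀₁ ++ concatMap blockArcs T₂₃ ++ map (renameArc old) (concatMap blockArcs D)
    concatMap-++³ T₀₁ T₂₃ = trans (concatMap-++ blockArcs T₀₁ _) (cong (concatMap blockArcs T₀₁ ++_)
      (trans (concatMap-++ blockArcs T₂₃ _) (cong (concatMap blockArcs T₂₃ ++_)
      (concatMap-blockArcs-renameBlock old (↑ʳ-injective 4 _ _) D))))
    open import Algebra.Solver.CommutativeMonoid (++-commutativeMonoid {A = Arc (4 + n)})
    regroup : (ab ad ac bc bd cd : Arc (4 + n)) (A B C D R : List (Arc (4 + n))) →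
      ab ∷ ad ∷ ac ∷ bc ∷ bd ∷ cd ∷ (A ++ B) ++ (C ++ D) ++ R ↭
      ab ∷ ac ∷ ad ∷ A ++ bc ∷ bd ∷ B ++ cd ∷ C ++ D ++ R
    regroup ab ad ac bc bd cd A B C D R =
      solve 11 (λ ab ad ac bc bd cd A B C D R →
        ab ⊕ ad ⊕ ac ⊕ bc ⊕ bd ⊕ cd ⊕ (A ⊕ B) ⊕ (C ⊕ D) ⊕ R ⊜
        ab ⊕ ac ⊕ ad ⊕ A ⊕ bc ⊕ bd ⊕ B ⊕ cd ⊕ C ⊕ D ⊕ R) ↭-refl
        [ ab ] [ ad ] [ ac ] [ bc ] [ bd ] [ cd ] A B C D R

  private
    count-tail-extend : (s : Shape) → s ≢ collider → (D : List (Block n)) →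
      count s (tabulate colliders₀₁ ++ tabulate colliders₂₃ ++ map renameOld D) ≡ count s D
    count-tail-extend s s≢collider D = begin
      count s (tabulate colliders₀₁ ++ tabulate colliders₂₃ ++ map renameOld D)
        ≡⟨ count-++ s (tabulate colliders₀₁) _ ⟩
      count s (tabulate colliders₀₁) + count s (tabulate colliders₂₃ ++ map renameOld D)
        ≡⟨ cong₂ _+_ (count-none s (tabulate colliders₀₁) (notCollider λ _ → refl))
                     (count-++ s (tabulate colliders₂₃) _) ⟩
      count s (tabulate colliders₂₃) + count s (map renameOld D)
        ≡⟨ cong₂ _+_ (count-none s (tabulate colliders₂₃) (notCollider λ _ → refl))
                     (count-map s renameOld (λ _ → refl) D) ⟩
      count s D ∎
      where
      open ≡-Reasoning
      notCollider : {h : Fin n → Block (4 + n)} → (∀ j → shape (h j) ≡ collider) → All (λ b → shape b ≢ s) (tabulate h)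
      notCollider colliders = tabulate⁺ λ j e → s≢collider (trans (sym e) (colliders j))

  count-fork-extend : (D : List (Block n)) → count fork (extend D) ≡ suc (count fork D)
  count-fork-extend D = cong suc (count-tail-extend fork (λ ()) D)

  count-chain-extend : (D : List (Block n)) → count chain (extend D) ≡ count chain D
  count-chain-extend = count-tail-extend chain (λ ())

length-ccfDecomposition : (D : List (Block n)) → IsCCFDecomposition n D → length D * 4 ≡ n * (n ∸ 1)
length-ccfDecomposition {n} D D↭ = begin
  length D * 4                       ≡⟨ *-assoc (length D) 2 2 ⟨
  length D * 2 * 2                   ≡⟨ cong (_* 2) (length-concatMap-blockArcs D) ⟨
  length (concatMap blockArcs D) * 2 ≡⟨ cong (_* 2) (↭-length D↭) ⟩
  length (arcsTT n) * 2              ≡⟨ length-arcsTT n ⟩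
  n * (n ∸ 1) ∎
  where open ≡-Reasoning

count-collider-ccfDecomposition : (D : List (Block n)) → IsCCFDecomposition n D → count chain D ≡ 0 →
  count collider D ≡ n * (n ∸ 1) / 4 ∸ count fork D
count-collider-ccfDecomposition {n} D D↭ no-chains = begin
  count collider D                                  ≡⟨ m+n∸n≡m (count collider D) (count fork D) ⟨
  count collider D + count fork D ∸ count fork D    ≡⟨ cong (_∸ count fork D) colliders+forks ⟩
  length D ∸ count fork D                           ≡⟨ cong (_∸ count fork D) blocks ⟩
  n * (n ∸ 1) / 4 ∸ count fork D ∎
  where
  open ≡-Reasoning
  colliders+forks : count collider D + count fork D ≡ length D
  colliders+forks = trans (cong (_+ (count collider D + count fork D)) (sym no-chains)) (count-shapes D)
  blocks : length D ≡ n * (n ∸ 1) / 4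
  blocks = trans (sym (m*n/n≡m (length D) 4)) (cong (_/ 4) (length-ccfDecomposition D D↭))

ccfDecomposition : (k r : ℕ) → r ≡ 0 ⊎ r ≡ 1 → Σ (List (Block (k * 4 + r))) λ D →
  IsCCFDecomposition (k * 4 + r) D × count fork D ≡ k × count chain D ≡ 0
ccfDecomposition zero r r≡0⊎1 = [] , noArcs r≡0⊎1 , refl , refl
  where
  noArcs : r ≡ 0 ⊎ r ≡ 1 → [] ↭ arcsTT r
  noArcs (inj₁ refl) = ↭-refl
  noArcs (inj₂ refl) = ↭-refl
ccfDecomposition (suc k) r r≡0⊎1 with ccfDecomposition k r r≡0⊎1
... | D , D↭ , forks , chains =
  extend D , extend-isCCFDecomposition D D↭ , trans (count-fork-extend D) (cong suc forks) , trans (count-chain-extend D) chains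

mainTheorem5 : (n : ℕ) → .{{_ : NonZero n}} → (n % 4 ≡ 0 ⊎ n % 4 ≡ 1) →
    Σ (List (Block n)) (λ D → IsCCFDecomposition n D
      × count fork D ≡ n / 4
      × count collider D ≡ (n * (n ∸ 1)) / 4 ∸ n / 4
      × count chain D ≡ 0)
mainTheorem5 n n%4≡0⊎1 =
  let D , D↭ , forks , chains = subst ForksAndNoChains n/4*4+n%4≡n (ccfDecomposition (n / 4) (n % 4) n%4≡0⊎1)
  in D , D↭ , forks , trans (count-collider-ccfDecomposition D D↭ chains) (cong (n * (n ∸ 1) / 4 ∸_) forks) , chains
  where
  n/4*4+n%4≡n : n / 4 * 4 + n % 4 ≡ n
  n/4*4+n%4≡n = trans (+-comm (n / 4 * 4) (n % 4)) (sym (m≡m%n+[m/n]*n n 4))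
  ForksAndNoChains : ℕ → Set
  ForksAndNoChains m = Σ (List (Block m)) λ D → IsCCFDecomposition m D × count fork D ≡ n / 4 × count chain D ≡ 0
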